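{- Let $k\ge 1$ and $n$ be integers with $n\ge k+3\ge 4$, and let $\overline{P_n}$ be the complement of the path $P_n$ of order $n$. Then $$\gamma_{t}^{r}(\overline{P_n})=\begin{cases} n & \text{if } n=4,\\ 2 & \text{if } n\ge 5,\end{cases}$$ and if $k\ge 2$, then $$\gamma_{\times k,t}^{r}(\overline{P_n})=\begin{cases} n & \text{if } n\le 2k+2,\\ k+2 & \text{if } 2k+3\le n\le 3k,\\ k+1 & \text{if } n\ge 3k+1.\end{cases}$$
   Context: All graphs are finite and simple; $N(x)$ denotes the open neighborhood of $x$. For an integer $k\ge 1$, a set $S\subseteq V(G)$ is a $k$-tuple total dominating set of $G$ if $|N(x)\cap S|\ge k$ for every $x\in V(G)$. It is a $k$-tuple total restrained dominating set (kTRDS) if moreover every vertex $x\in V(G)\setminus S$ is adjacent to at least $k$ vertices of $V(G)\setminus S$. For a graph with minimum degree at least $k$, $\gamma_{\times k,t}^{r}(G)$ denotes the minimum cardinality of a kTRDS of $G$; $\gamma_t^r(G)=\gamma_{\times 1,t}^{r}(G)$ is the total restrained domination number. $\overline{H}$ denotes the complement of a graph $H$. -}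

module Defs where

open import Data.Nat using (ℕ; zero; suc; _≤_)
open import Data.Nat.Base using (_≡ᵇ_)
open import Data.Bool using (Bool; true; false; not; _∧_; _∨_; T)
open import Data.Fin using (Fin; toℕ; _≟_)
open import Data.Fin.Subset using (Subset; _∈_; _∉_; _∩_; ∁; ∣_∣)
open import Data.Vec using (tabulate)
open import Data.Product using (Σ; _×_)
open import Relation.Binary.PropositionalEquality using (_≡_; refl; cong; cong₂) renaming (sym to ≡-sym)
open import Relation.Nullary using (yes; no)
open import Data.Empty using (⊥-elim)
open import Data.Bool.Properties using (∨-comm)
open import Relation.Nullary.Decidable using (⌊_⌋)

record Graph (n : ℕ) : Set where
  field
    adj   : Fin n → Fin n → Bool
    irrefl : ∀ x → adj x x ≡ false
    sym   : ∀ x y → adj x y ≡ adj y x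
open Graph public

N : ∀ {n} → Graph n → Fin n → Subset n
N G x = tabulate (adj G x)

IsKTRDS : ∀ {n} → Graph n → ℕ → Subset n → Set
IsKTRDS G k S =
  (∀ x → k ≤ ∣ N G x ∩ S ∣) ×
  (∀ x → x ∉ S → k ≤ ∣ N G x ∩ ∁ S ∣)

GammaKTR≡ : ∀ {n} → Graph n → ℕ → ℕ → Set
GammaKTR≡ G k m =
  Σ (Subset _) (λ S → IsKTRDS G k S × ∣ S ∣ ≡ m) ×
  (∀ S → IsKTRDS G k S → m ≤ ∣ S ∣)

pathAdj : ∀ {n} → Fin n → Fin n → Bool
pathAdj i j = (suc (toℕ i) ≡ᵇ toℕ j) ∨ (suc (toℕ j) ≡ᵇ toℕ i)

private
  sucᵇ : ∀ m → (suc m ≡ᵇ m) ≡ false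
  sucᵇ zero = refl
  sucᵇ (suc m) = sucᵇ m

P : (n : ℕ) → Graph n
P n = record
  { adj = pathAdj
  ; irrefl = λ x → cong₂ _∨_ (sucᵇ (toℕ x)) (sucᵇ (toℕ x))
  ; sym = λ x y → ∨-comm (suc (toℕ x) ≡ᵇ toℕ y) (suc (toℕ y) ≡ᵇ toℕ x)
  }

private
  eqb : ∀ {n} → Fin n → Fin n → Bool
  eqb i j = ⌊ i ≟ j ⌋

  eqb-refl : ∀ {n} (x : Fin n) → eqb x x ≡ true
  eqb-refl x with x ≟ x
  ... | yes _ = refl
  ... | no ¬p = ⊥-elim (¬p refl)

  eqb-sym : ∀ {n} (x y : Fin n) → eqb x y ≡ eqb y x
  eqb-sym x y with x ≟ y | y ≟ x
  ... | yes _ | yes _ = refl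
  ... | no _ | no _ = refl
  ... | yes p | no q = ⊥-elim (q (≡-sym p))
  ... | no p | yes q = ⊥-elim (p (≡-sym q))

complement : ∀ {n} → Graph n → Graph n
complement G = record
  { adj = λ x y → not (eqb x y) ∧ not (adj G x y)
  ; irrefl = λ x → cong (λ b → not b ∧ not (adj G x x)) (eqb-refl x)
  ; sym = λ x y → cong₂ (λ a b → not a ∧ not b) (eqb-sym x y) (Graph.sym G x y)
  }

-- In the complement of P_n a vertex x is adjacent to everything outside the window
-- {x - 1, x, x + 1}, so every bound counts how many members of S, or of its complement,
-- fit into one window.  Lower bounds: a member of S misses itself, so |S| ≥ k + 1; two
-- members of S at path distance at most 2 share a non-neighbour, so if |S| = k + 1 they
-- are pairwise 3 apart, whence 3|S| ≤ n + 2 and n ≥ 3k + 1; a vertex outside S has k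
-- neighbours in S and k outside it, which forces n ≥ 2k + 3.  The values are attained by
-- V, by the positions 0, 2, …, 2k + 2 and by the positions 0, 3, …, 3k.

module Submission where

open import Defs
open import Data.Bool using (Bool; true; false; not; T)
open import Data.Bool.Properties using (T-≡; T-∧; T-∨)
open import Data.Empty using (⊥; ⊥-elim)
open import Data.Fin using (Fin; toℕ; fromℕ<; _≟_) renaming (zero to fzero; suc to fsuc; _<_ to _<ᶠ_)
open import Data.Fin.Properties using (toℕ-injective; toℕ-fromℕ<; toℕ<n) renaming (<⇒≢ to <⇒≢ᶠ)
open import Data.Fin.Subset using (Subset; _∈_; _∉_; _∩_; ∁; ∣_∣; ⊤; ⁅_⁆; _-_; Nonempty)
open import Data.Fin.Subset.Properties
  using (∈⊤; x∈p∩q⁺; x∈p∩q⁻; x∉p⇒x∈∁p; x∈∁p⇒x∉p; x∉⁅y⁆⇒x≢y; ∣p∩q∣≤∣p∣; ∣⁅x⁆∣≡1;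
         ∣p∣≤n; ∣∁p∣≡n∸∣p∣; ∣⊤∣≡n; _∈?_; x∈p∧x≢y⇒x∈p-y; x∈p⇒∣p-x∣<∣p∣; ∩-comm; ∩-identityʳ)
open import Data.List using (List; []; _∷_; [_]; length)
open import Data.List.Membership.Propositional using () renaming (_∈_ to _∈ˡ_)
open import Data.List.Relation.Unary.All using (All; []; _∷_)
import Data.List.Relation.Unary.All as All
open import Data.List.Relation.Unary.AllPairs using (AllPairs; []; _∷_)
open import Data.List.Relation.Unary.Any using () renaming (here to hereˡ; there to thereˡ)
open import Data.Nat using (ℕ; zero; suc; _≤_; _<_; _+_; _*_; _∸_; _≤?_; _<?_; z≤n; s≤s)
open import Data.Nat.Properties hiding (_≟_)
open import Data.Nat.Tactic.RingSolver using (solve-∀)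
open import Data.Product using (Σ; _×_; _,_; proj₁; proj₂)
open import Data.Sum using (_⊎_; inj₁; inj₂)
import Data.Sum
open import Data.Vec using ([]; _∷_; tabulate; here; there)
open import Data.Vec.Properties using (lookup∘tabulate; tabulate-∘; []=⇒lookup; lookup⇒[]=)
open import Function using (_∘_; Equivalence)
open import Relation.Binary.PropositionalEquality
  using (_≡_; _≢_; refl; cong; cong₂; subst; trans; module ≡-Reasoning) renaming (sym to ≡-sym)
open import Relation.Nullary using (¬_; yes; no)
open import Relation.Nullary.Decidable using (T?; ⌊_⌋)

∣p∩q∣+∣∁p∩q∣≡∣q∣ : ∀ {n} (p q : Subset n) → ∣ p ∩ q ∣ + ∣ ∁ p ∩ q ∣ ≡ ∣ q ∣
∣p∩q∣+∣∁p∩q∣≡∣q∣ []          []          = refl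
∣p∩q∣+∣∁p∩q∣≡∣q∣ (true  ∷ p) (true  ∷ q) = cong suc (∣p∩q∣+∣∁p∩q∣≡∣q∣ p q)
∣p∩q∣+∣∁p∩q∣≡∣q∣ (false ∷ p) (true  ∷ q) = trans (+-suc _ _) (cong suc (∣p∩q∣+∣∁p∩q∣≡∣q∣ p q))
∣p∩q∣+∣∁p∩q∣≡∣q∣ (true  ∷ p) (false ∷ q) = ∣p∩q∣+∣∁p∩q∣≡∣q∣ p q
∣p∩q∣+∣∁p∩q∣≡∣q∣ (false ∷ p) (false ∷ q) = ∣p∩q∣+∣∁p∩q∣≡∣q∣ p q

∣p∣+∣∁p∣≡n : ∀ {n} (p : Subset n) → ∣ p ∣ + ∣ ∁ p ∣ ≡ n
∣p∣+∣∁p∣≡n p = trans (cong (∣ p ∣ +_) (∣∁p∣≡n∸∣p∣ p)) (m+[n∸m]≡n (∣p∣≤n p))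

m+∣p∣≤n⇒m≤∣∁p∣ : ∀ {n} m (p : Subset n) → m + ∣ p ∣ ≤ n → m ≤ ∣ ∁ p ∣
m+∣p∣≤n⇒m≤∣∁p∣ m p le = subst (m ≤_) (≡-sym (∣∁p∣≡n∸∣p∣ p)) (m+n≤o⇒m≤o∸n m le)

0<∣p∣⇒Nonempty : ∀ {n} (p : Subset n) → 0 < ∣ p ∣ → Nonempty p
0<∣p∣⇒Nonempty (true  ∷ p) _  = fzero , here
0<∣p∣⇒Nonempty (false ∷ p) lt with 0<∣p∣⇒Nonempty p lt
... | x , x∈p = fsuc x , there x∈p

∈-tabulate⁺ : ∀ {n} {f : Fin n → Bool} {x} → T (f x) → x ∈ tabulate f
∈-tabulate⁺ {f = f} {x} t = lookup⇒[]= x _ (trans (lookup∘tabulate f x) (Equivalence.to T-≡ t))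

∈-tabulate⁻ : ∀ {n} {f : Fin n → Bool} {x} → x ∈ tabulate f → T (f x)
∈-tabulate⁻ {f = f} {x} x∈ = Equivalence.from T-≡ (trans (≡-sym (lookup∘tabulate f x)) ([]=⇒lookup x∈))

distinct⇒length≤∣p∣ : ∀ {n} {p : Subset n} {xs : List (Fin n)} →
                      AllPairs _≢_ xs → All (_∈ p) xs → length xs ≤ ∣ p ∣
distinct⇒length≤∣p∣ [] [] = z≤n
distinct⇒length≤∣p∣ (x≢xs ∷ xs-distinct) (x∈p ∷ xs⊆p) =
  ≤-trans (s≤s (distinct⇒length≤∣p∣ xs-distinct (All.zipWith in-p-x (xs⊆p , x≢xs))))
          (x∈p⇒∣p-x∣<∣p∣ x∈p)
  where
  in-p-x : ∀ {x y} {p : Subset _} → y ∈ p × x ≢ y → y ∈ p - x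
  in-p-x (y∈p , x≢y) = x∈p∧x≢y⇒x∈p-y y∈p (x≢y ∘ ≡-sym)

∣p∣≤length : ∀ {n} {p : Subset n} (is : List ℕ) →
             (∀ {x} → x ∈ p → toℕ x ∈ˡ is) → ∣ p ∣ ≤ length is
∣p∣≤length {p = p} [] indexed = ≮⇒≥ (λ 0<∣p∣ → no-index (0<∣p∣⇒Nonempty p 0<∣p∣))
  where
  no-index : ¬ Nonempty p
  no-index (x , x∈p) with indexed x∈p
  ... | ()
∣p∣≤length {n} {p} (i ∷ is) indexed with i <? n
... | no i≮n = ≤-trans (∣p∣≤length is (λ x∈p → tail x∈p (indexed x∈p))) (n≤1+n _)
  where
  tail : ∀ {x} → x ∈ p → toℕ x ∈ˡ i ∷ is → toℕ x ∈ˡ is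
  tail {x} _ (hereˡ x≡i) = ⊥-elim (i≮n (subst (_< n) x≡i (toℕ<n x)))
  tail _ (thereˡ x∈is) = x∈is
... | yes i<n = begin
  ∣ p ∣                          ≡⟨ ∣p∩q∣+∣∁p∩q∣≡∣q∣ ⁅ y ⁆ p ⟨
  ∣ ⁅ y ⁆ ∩ p ∣ + ∣ ∁ ⁅ y ⁆ ∩ p ∣  ≤⟨ +-mono-≤ (≤-trans (∣p∩q∣≤∣p∣ ⁅ y ⁆ p) (≤-reflexive (∣⁅x⁆∣≡1 y)))
                                              (∣p∣≤length is rest-indexed) ⟩
  suc (length is)                ∎
  where
  open ≤-Reasoning
  y = fromℕ< i<n
  rest-indexed : ∀ {x} → x ∈ ∁ ⁅ y ⁆ ∩ p → toℕ x ∈ˡ is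
  rest-indexed {x} x∈ with x∈p∩q⁻ (∁ ⁅ y ⁆) p x∈
  ... | x∉y , x∈p with indexed x∈p
  ...   | hereˡ x≡i  = ⊥-elim (x∉⁅y⁆⇒x≢y (x∈∁p⇒x∉p x∉y) (toℕ-injective (trans x≡i (≡-sym (toℕ-fromℕ< i<n)))))
  ...   | thereˡ x∈is = x∈is

module _ {n} (G : Graph n) where

  x∉N[x] : ∀ x → x ∉ N G x
  x∉N[x] x x∈N = subst T (irrefl G x) (∈-tabulate⁻ x∈N)

  k≤∣N∩A∣⇒k+∣xs∣≤∣A∣ : ∀ {k x A} {xs : List (Fin n)} → k ≤ ∣ N G x ∩ A ∣ →
                       AllPairs _≢_ xs → All (_∈ A) xs → All (_∉ N G x) xs → k + length xs ≤ ∣ A ∣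
  k≤∣N∩A∣⇒k+∣xs∣≤∣A∣ {k} {x} {A} {xs} k≤ xs-distinct xs⊆A xs∉N = begin
    k + length xs                    ≤⟨ +-mono-≤ k≤ (distinct⇒length≤∣p∣ xs-distinct xs⊆∁N∩A) ⟩
    ∣ N G x ∩ A ∣ + ∣ ∁ (N G x) ∩ A ∣  ≡⟨ ∣p∩q∣+∣∁p∩q∣≡∣q∣ (N G x) A ⟩
    ∣ A ∣                            ∎
    where
    open ≤-Reasoning
    xs⊆∁N∩A : All (_∈ ∁ (N G x) ∩ A) xs
    xs⊆∁N∩A = All.zipWith (λ (y∉N , y∈A) → x∈p∩q⁺ (x∉p⇒x∈∁p y∉N , y∈A)) (xs∉N , xs⊆A)

  k+∣is∣≤∣A∣⇒k≤∣N∩A∣ : ∀ {k x A} (is : List ℕ) → k + length is ≤ ∣ A ∣ →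
                       (∀ {y} → y ∈ A → y ∉ N G x → toℕ y ∈ˡ is) → k ≤ ∣ N G x ∩ A ∣
  k+∣is∣≤∣A∣⇒k≤∣N∩A∣ {k} {x} {A} is k+∣is∣≤ indexed = +-cancelʳ-≤ (length is) k _ (begin
    k + length is                    ≤⟨ k+∣is∣≤ ⟩
    ∣ A ∣                            ≡⟨ ∣p∩q∣+∣∁p∩q∣≡∣q∣ (N G x) A ⟨
    ∣ N G x ∩ A ∣ + ∣ ∁ (N G x) ∩ A ∣  ≤⟨ +-monoʳ-≤ ∣ N G x ∩ A ∣ (∣p∣≤length is ∁N∩A-indexed) ⟩
    ∣ N G x ∩ A ∣ + length is        ∎)
    where
    open ≤-Reasoning
    ∁N∩A-indexed : ∀ {y} → y ∈ ∁ (N G x) ∩ A → toℕ y ∈ˡ is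
    ∁N∩A-indexed y∈ with x∈p∩q⁻ (∁ (N G x)) A y∈
    ... | y∉N , y∈A = indexed y∈A (x∈∁p⇒x∉p y∉N)

  ∣N∣+∣xs∣≤n : ∀ {x} {xs : List (Fin n)} → AllPairs _≢_ xs → All (_∉ N G x) xs → ∣ N G x ∣ + length xs ≤ n
  ∣N∣+∣xs∣≤n {x} xs-distinct xs∉N = begin
    ∣ N G x ∣ + _  ≤⟨ k≤∣N∩A∣⇒k+∣xs∣≤∣A∣ (≤-reflexive (cong ∣_∣ (≡-sym (∩-identityʳ (N G x)))))
                                      xs-distinct (All.map (λ _ → ∈⊤) xs∉N) xs∉N ⟩
    ∣ ⊤ {n} ∣       ≡⟨ ∣⊤∣≡n n ⟩
    n              ∎
    where open ≤-Reasoning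

  module _ {k S} (S-kTRDS : IsKTRDS G k S) where

    kTRDS⇒k+1≤∣S∣ : 1 ≤ k → 0 < n → k + 1 ≤ ∣ S ∣
    kTRDS⇒k+1≤∣S∣ 1≤k 0<n with 0<∣p∣⇒Nonempty (N G x₀ ∩ S) (≤-trans 1≤k (proj₁ S-kTRDS x₀))
      where x₀ = fromℕ< 0<n
    ... | u , u∈N∩S = k≤∣N∩A∣⇒k+∣xs∣≤∣A∣ (proj₁ S-kTRDS u) ([] ∷ [])
                        (proj₂ (x∈p∩q⁻ _ S u∈N∩S) ∷ []) (x∉N[x] u ∷ [])

    nonNeighbour-pair⇒k+2≤∣S∣ : ∀ {m u v} → u ∈ S → v ∈ S → u ≢ v → u ∉ N G m → v ∉ N G m → k + 2 ≤ ∣ S ∣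
    nonNeighbour-pair⇒k+2≤∣S∣ {m} u∈S v∈S u≢v u∉N v∉N =
      k≤∣N∩A∣⇒k+∣xs∣≤∣A∣ (proj₁ S-kTRDS m) ((u≢v ∷ []) ∷ [] ∷ []) (u∈S ∷ v∈S ∷ []) (u∉N ∷ v∉N ∷ [])

    outsider⇒k+1≤∣∁S∣ : ∀ {x} → x ∉ S → k + 1 ≤ ∣ ∁ S ∣
    outsider⇒k+1≤∣∁S∣ {x} x∉S =
      k≤∣N∩A∣⇒k+∣xs∣≤∣A∣ (proj₂ S-kTRDS x x∉S) ([] ∷ []) (x∉p⇒x∈∁p x∉S ∷ []) (x∉N[x] x ∷ [])

    outsider⇒k+k≤∣N∣ : ∀ {x} → x ∉ S → k + k ≤ ∣ N G x ∣
    outsider⇒k+k≤∣N∣ {x} x∉S = begin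
      k + k                          ≤⟨ +-mono-≤ (proj₁ S-kTRDS x) (proj₂ S-kTRDS x x∉S) ⟩
      ∣ N G x ∩ S ∣ + ∣ N G x ∩ ∁ S ∣  ≡⟨ cong₂ (λ p q → ∣ p ∣ + ∣ q ∣) (∩-comm (N G x) S) (∩-comm (N G x) (∁ S)) ⟩
      ∣ S ∩ N G x ∣ + ∣ ∁ S ∩ N G x ∣  ≡⟨ ∣p∩q∣+∣∁p∩q∣≡∣q∣ S (N G x) ⟩
      ∣ N G x ∣                      ∎
      where open ≤-Reasoning

¬T⇒T-not : ∀ {b} → ¬ T b → T (not b)
¬T⇒T-not {true}  ¬t = ¬t _
¬T⇒T-not {false} _  = _

T⇒¬T-not : ∀ {b} → T b → ¬ T (not b)
T⇒¬T-not {true} _ ()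

x≢y⇒T-not⌊x≟y⌋ : ∀ {n} {x y : Fin n} → x ≢ y → T (not ⌊ x ≟ y ⌋)
x≢y⇒T-not⌊x≟y⌋ {x = x} {y} x≢y with x ≟ y
... | yes x≡y = x≢y x≡y
... | no _    = _

T-not⌊x≟y⌋⇒x≢y : ∀ {n} {x y : Fin n} → T (not ⌊ x ≟ y ⌋) → x ≢ y
T-not⌊x≟y⌋⇒x≢y {x = x} {y} t x≡y with x ≟ y
... | yes _  = t
... | no x≢y = x≢y x≡y

Pᶜ : (n : ℕ) → Graph n
Pᶜ n = complement (P n)

Near : ℕ → ℕ → Set
Near i j = j ≡ i ⊎ j ≡ suc i ⊎ suc j ≡ i

ShortHop : ℕ → ℕ → Set
ShortHop i j = j ≡ suc i ⊎ j ≡ suc (suc i)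

module _ {n} {x y : Fin n} where

  ∉Nᶜ⇒Near : y ∉ N (Pᶜ n) x → Near (toℕ x) (toℕ y)
  ∉Nᶜ⇒Near y∉N with x ≟ y
  ... | yes x≡y = inj₁ (cong toℕ (≡-sym x≡y))
  ... | no x≢y with T? (pathAdj x y)
  ...   | no ¬adj =
    ⊥-elim (y∉N (∈-tabulate⁺ (Equivalence.from T-∧ (x≢y⇒T-not⌊x≟y⌋ x≢y , ¬T⇒T-not ¬adj))))
  ...   | yes adj with Equivalence.to T-∨ adj
  ...     | inj₁ x+1≡y = inj₂ (inj₁ (≡-sym (≡ᵇ⇒≡ _ _ x+1≡y)))
  ...     | inj₂ y+1≡x = inj₂ (inj₂ (≡ᵇ⇒≡ _ _ y+1≡x))

  Near⇒∉Nᶜ : Near (toℕ x) (toℕ y) → y ∉ N (Pᶜ n) x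
  Near⇒∉Nᶜ near y∈N with Equivalence.to (T-∧ {not ⌊ x ≟ y ⌋} {not (pathAdj x y)}) (∈-tabulate⁻ y∈N)
  ... | distinct , ¬adj with near
  ...   | inj₁ y≡x = T-not⌊x≟y⌋⇒x≢y distinct (toℕ-injective (≡-sym y≡x))
  ...   | inj₂ (inj₁ y≡x+1) = T⇒¬T-not (Equivalence.from T-∨ (inj₁ (≡⇒≡ᵇ _ _ (≡-sym y≡x+1)))) ¬adj
  ...   | inj₂ (inj₂ y+1≡x) = T⇒¬T-not (Equivalence.from T-∨ (inj₂ (≡⇒≡ᵇ _ _ y+1≡x))) ¬adj

module _ {n k} {S : Subset n} (S-kTRDS : IsKTRDS (Pᶜ n) k S) where

  interior-outsider⇒k+k+3≤n : ∀ {a x b} → x ∉ S →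
                              toℕ x ≡ suc (toℕ a) → toℕ b ≡ suc (toℕ x) → k + k + 3 ≤ n
  interior-outsider⇒k+k+3≤n {a} {x} {b} x∉S x≡a+1 b≡x+1 = begin
    k + k + 3          ≤⟨ +-monoˡ-≤ 3 (outsider⇒k+k≤∣N∣ (Pᶜ n) S-kTRDS x∉S) ⟩
    ∣ N (Pᶜ n) x ∣ + 3  ≤⟨ ∣N∣+∣xs∣≤n (Pᶜ n) ((a≢x ∷ a≢b ∷ []) ∷ (x≢b ∷ []) ∷ [] ∷ [])
                           (Near⇒∉Nᶜ (inj₂ (inj₂ (≡-sym x≡a+1))) ∷ x∉N[x] (Pᶜ n) x
                            ∷ Near⇒∉Nᶜ (inj₂ (inj₁ b≡x+1)) ∷ []) ⟩
    n                  ∎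
    where
    open ≤-Reasoning
    a<x : a <ᶠ x
    a<x = ≤-reflexive (≡-sym x≡a+1)
    x<b : x <ᶠ b
    x<b = ≤-reflexive (≡-sym b≡x+1)
    a≢x = <⇒≢ᶠ a<x
    x≢b = <⇒≢ᶠ x<b
    a≢b = <⇒≢ᶠ (<-trans a<x x<b)

  shortHop-in-S⇒k+2≤∣S∣ : ∀ {i j} → i ∈ S → j ∈ S → ShortHop (toℕ i) (toℕ j) → k + 2 ≤ ∣ S ∣
  shortHop-in-S⇒k+2≤∣S∣ {i} {j} i∈S j∈S (inj₁ j≡i+1) =
    nonNeighbour-pair⇒k+2≤∣S∣ (Pᶜ n) S-kTRDS i∈S j∈S (<⇒≢ᶠ (≤-reflexive (≡-sym j≡i+1)))
      (x∉N[x] (Pᶜ n) i) (Near⇒∉Nᶜ (inj₂ (inj₁ j≡i+1)))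
  shortHop-in-S⇒k+2≤∣S∣ {i} {j} i∈S j∈S (inj₂ j≡i+2) =
    nonNeighbour-pair⇒k+2≤∣S∣ (Pᶜ n) S-kTRDS {m = m} i∈S j∈S (<⇒≢ᶠ (≤-trans (n≤1+n _) (≤-reflexive (≡-sym j≡i+2))))
      (Near⇒∉Nᶜ (inj₂ (inj₂ (≡-sym m≡i+1)))) (Near⇒∉Nᶜ (inj₂ (inj₁ (trans j≡i+2 (cong suc (≡-sym m≡i+1))))))
    where
    m = fromℕ< (≤-trans (n≤1+n _) (subst (_< n) j≡i+2 (toℕ<n j)))
    m≡i+1 : toℕ m ≡ suc (toℕ i)
    m≡i+1 = toℕ-fromℕ< _

  path-edge-in-S⇒k+k+3≤n : ∀ {x u v} → x ∉ S → u ∈ S → v ∈ S → toℕ v ≡ suc (toℕ u) → k + k + 3 ≤ n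
  path-edge-in-S⇒k+k+3≤n {x} {u} {v} x∉S u∈S v∈S v≡u+1 = begin
    k + k + 3          ≡⟨ regroup k ⟩
    (k + 2) + (k + 1)  ≤⟨ +-mono-≤ (shortHop-in-S⇒k+2≤∣S∣ u∈S v∈S (inj₁ v≡u+1))
                                   (outsider⇒k+1≤∣∁S∣ (Pᶜ n) S-kTRDS x∉S) ⟩
    ∣ S ∣ + ∣ ∁ S ∣      ≡⟨ ∣p∣+∣∁p∣≡n S ⟩
    n                  ∎
    where
    open ≤-Reasoning
    regroup : ∀ k → k + k + 3 ≡ (k + 2) + (k + 1)
    regroup = solve-∀

-- The path vertices 1 and 2 both have two path neighbours; if both lie in S they form a path edge in S.
outsider⇒k+k+3≤n : ∀ {n k} {S : Subset n} → 4 ≤ n → IsKTRDS (Pᶜ n) k S → ∀ {x} → x ∉ S → k + k + 3 ≤ n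
outsider⇒k+k+3≤n {S = S} (s≤s (s≤s (s≤s (s≤s _)))) S-kTRDS x∉S
  with fsuc fzero ∈? S | fsuc (fsuc fzero) ∈? S
... | no v₁∉S  | _        = interior-outsider⇒k+k+3≤n S-kTRDS {a = fzero} v₁∉S refl refl
... | yes _    | no v₂∉S  = interior-outsider⇒k+k+3≤n S-kTRDS {a = fsuc fzero} v₂∉S refl refl
... | yes v₁∈S | yes v₂∈S = path-edge-in-S⇒k+k+3≤n S-kTRDS x∉S v₁∈S v₂∈S refl

n≤2k+2⇒n≤∣S∣ : ∀ {n k} {S : Subset n} → 4 ≤ n → n ≤ 2 * k + 2 → IsKTRDS (Pᶜ n) k S → n ≤ ∣ S ∣
n≤2k+2⇒n≤∣S∣ {n} {k} {S} 4≤n n≤2k+2 S-kTRDS = ≮⇒≥ λ ∣S∣<n →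
  let (x , x∈∁S) = 0<∣p∣⇒Nonempty (∁ S) (m+∣p∣≤n⇒m≤∣∁p∣ 1 S ∣S∣<n) in
  <-irrefl refl (≤-trans (≤-reflexive (regroup k))
                  (≤-trans (outsider⇒k+k+3≤n 4≤n S-kTRDS (x∈∁p⇒x∉p x∈∁S)) n≤2k+2))
  where
  regroup : ∀ k → suc (2 * k + 2) ≡ k + k + 3
  regroup = solve-∀

Sparse : ∀ {n} → Subset n → Set
Sparse S = ∀ {i j} → i ∈ S → j ∈ S → ¬ ShortHop (toℕ i) (toℕ j)

Sparse-tail : ∀ {n b} {S : Subset n} → Sparse (b ∷ S) → Sparse S
Sparse-tail sparse i∈S j∈S hop = sparse (there i∈S) (there j∈S) (Data.Sum.map (cong suc) (cong suc) hop)

Sparse⇒3∣S∣≤n+2 : ∀ {n} (S : Subset n) → Sparse S → 3 * ∣ S ∣ ≤ n + 2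
Sparse⇒3∣S∣≤n+2 [] _ = z≤n
Sparse⇒3∣S∣≤n+2 (false ∷ S) sparse = ≤-trans (Sparse⇒3∣S∣≤n+2 S (Sparse-tail sparse)) (n≤1+n _)
Sparse⇒3∣S∣≤n+2 (true ∷ []) _ = ≤-refl
Sparse⇒3∣S∣≤n+2 (true ∷ true ∷ S) sparse = ⊥-elim (sparse here (there here) (inj₁ refl))
Sparse⇒3∣S∣≤n+2 (true ∷ false ∷ []) _ = n≤1+n _
Sparse⇒3∣S∣≤n+2 (true ∷ false ∷ true ∷ S) sparse = ⊥-elim (sparse here (there (there here)) (inj₂ refl))
Sparse⇒3∣S∣≤n+2 (true ∷ false ∷ false ∷ S) sparse =
  ≤-trans (≤-reflexive (*-suc 3 ∣ S ∣))
          (+-monoʳ-≤ 3 (Sparse⇒3∣S∣≤n+2 S (Sparse-tail (Sparse-tail (Sparse-tail sparse)))))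

n≤3k⇒k+2≤∣S∣ : ∀ {n k} {S : Subset n} → 1 ≤ k → 0 < n → n ≤ 3 * k → IsKTRDS (Pᶜ n) k S → k + 2 ≤ ∣ S ∣
n≤3k⇒k+2≤∣S∣ {n} {k} {S} 1≤k 0<n n≤3k S-kTRDS with k + 2 ≤? ∣ S ∣
... | yes k+2≤∣S∣ = k+2≤∣S∣
... | no k+2≰∣S∣ = ⊥-elim (<-irrefl refl (begin-strict
  3 * k + 2      <⟨ ≤-reflexive (regroup k) ⟩
  3 * (k + 1)    ≤⟨ *-monoʳ-≤ 3 (kTRDS⇒k+1≤∣S∣ (Pᶜ n) S-kTRDS 1≤k 0<n) ⟩
  3 * ∣ S ∣      ≤⟨ Sparse⇒3∣S∣≤n+2 S sparse ⟩
  n + 2          ≤⟨ +-monoˡ-≤ 2 n≤3k ⟩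
  3 * k + 2      ∎))
  where
  open ≤-Reasoning
  regroup : ∀ k → suc (3 * k + 2) ≡ 3 * (k + 1)
  regroup = solve-∀
  sparse : Sparse S
  sparse i∈S j∈S hop = k+2≰∣S∣ (shortHop-in-S⇒k+2≤∣S∣ S-kTRDS i∈S j∈S hop)

marks : (n : ℕ) → (ℕ → Bool) → Subset n
marks n g = tabulate (g ∘ toℕ)

∁-marks : ∀ n g → ∁ (marks n g) ≡ marks n (not ∘ g)
∁-marks n g = ≡-sym (tabulate-∘ not (g ∘ toℕ))

∉marks⇒T-not : ∀ {n} g {x : Fin n} → x ∉ marks n g → T (not (g (toℕ x)))
∉marks⇒T-not {n} g x∉ = ∈-tabulate⁻ (subst (_ ∈_) (∁-marks n g) (x∉p⇒x∈∁p x∉))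

∣marks-none∣ : ∀ n → ∣ marks n (λ _ → false) ∣ ≡ 0
∣marks-none∣ zero    = refl
∣marks-none∣ (suc n) = ∣marks-none∣ n

MarksNear≤ : ℕ → (ℕ → Bool) → ℕ → ℕ → Set
MarksNear≤ n g i c = Σ (List ℕ) λ is → length is ≤ c × (∀ {j} → j < n → Near i j → T (g j) → j ∈ˡ is)

window : ℕ → List ℕ
window i = i ∸ 1 ∷ i ∷ suc i ∷ []

Near⇒∈window : ∀ {i j} → Near i j → j ∈ˡ window i
Near⇒∈window (inj₁ refl)         = thereˡ (hereˡ refl)
Near⇒∈window (inj₂ (inj₁ refl))  = thereˡ (thereˡ (hereˡ refl))
Near⇒∈window (inj₂ (inj₂ j+1≡i)) = hereˡ (cong (_∸ 1) j+1≡i)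

marksNear≤3 : ∀ {n} g i → MarksNear≤ n g i 3
marksNear≤3 g i = window i , ≤-refl , λ _ near _ → Near⇒∈window near

marks-neighbours : ∀ {n k c g} (x : Fin n) → k + c ≤ ∣ marks n g ∣ → MarksNear≤ n g (toℕ x) c →
                   k ≤ ∣ N (Pᶜ n) x ∩ marks n g ∣
marks-neighbours {n} {k} x k+c≤ (is , ∣is∣≤c , listed) =
  k+∣is∣≤∣A∣⇒k≤∣N∩A∣ (Pᶜ n) is (≤-trans (+-monoʳ-≤ k ∣is∣≤c) k+c≤)
    (λ {y} y∈ y∉N → listed (toℕ<n y) (∉Nᶜ⇒Near y∉N) (∈-tabulate⁻ y∈))

unmarked-neighbours : ∀ {n k c} g (x : Fin n) → k + c ≤ ∣ ∁ (marks n g) ∣ → MarksNear≤ n (not ∘ g) (toℕ x) c →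
                      k ≤ ∣ N (Pᶜ n) x ∩ ∁ (marks n g) ∣
unmarked-neighbours {n} g x rewrite ∁-marks n g = marks-neighbours x

⊤-kTRDS : ∀ {n k} → k + 3 ≤ n → IsKTRDS (Pᶜ n) k ⊤
⊤-kTRDS {n} {k} k+3≤n = dominating , λ _ x∉⊤ → ⊥-elim (x∉⊤ ∈⊤)
  where
  dominating : ∀ x → k ≤ ∣ N (Pᶜ n) x ∩ ⊤ ∣
  dominating x = k+∣is∣≤∣A∣⇒k≤∣N∩A∣ (Pᶜ n) (window (toℕ x)) (subst (k + 3 ≤_) (≡-sym (∣⊤∣≡n n)) k+3≤n)
                   (λ _ y∉N → Near⇒∈window (∉Nᶜ⇒Near y∉N))

everyOther : ℕ → ℕ → Bool
everyOther k       zero          = true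
everyOther zero    (suc i)       = false
everyOther (suc k) (suc zero)    = false
everyOther (suc k) (suc (suc i)) = everyOther k i

∣marks-everyOther∣ : ∀ k n → 2 * k + 1 ≤ n → ∣ marks n (everyOther k) ∣ ≡ k + 1
∣marks-everyOther∣ zero    (suc n) _    = cong suc (∣marks-none∣ n)
∣marks-everyOther∣ (suc k) n       2k+3≤n = shifted n (subst (_≤ n) (regroup k) 2k+3≤n)
  where
  regroup : ∀ k → 2 * suc k + 1 ≡ 2 + (2 * k + 1)
  regroup = solve-∀
  shifted : ∀ n → 2 + (2 * k + 1) ≤ n → ∣ marks n (everyOther (suc k)) ∣ ≡ suc k + 1
  shifted (suc (suc n)) (s≤s (s≤s 2k+1≤n)) = cong suc (∣marks-everyOther∣ k n 2k+1≤n)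

∣marks-everyOther-suc∣ : ∀ {n} k → 2 * k + 3 ≤ n → ∣ marks n (everyOther (suc k)) ∣ ≡ k + 2
∣marks-everyOther-suc∣ {n} k 2k+3≤n =
  trans (∣marks-everyOther∣ (suc k) n (subst (_≤ n) (regroup k) 2k+3≤n)) (≡-sym (+-suc k 1))
  where
  regroup : ∀ k → 2 * k + 3 ≡ 2 * suc k + 1
  regroup = solve-∀

everyOther-apart : ∀ k i → T (everyOther k i) → ¬ T (everyOther k (suc i))
everyOther-apart zero    zero          _ ()
everyOther-apart (suc k) zero          _ ()
everyOther-apart (suc k) (suc zero)    ()
everyOther-apart (suc k) (suc (suc i)) = everyOther-apart k i

everyOther-unmarked-pair : ∀ k i → T (not (everyOther k i)) → T (not (everyOther k (suc i))) → 2 * k + 1 ≤ i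
everyOther-unmarked-pair zero    (suc i)       _ _ = s≤s z≤n
everyOther-unmarked-pair (suc k) (suc (suc i)) i-unmarked i+1-unmarked =
  subst (_≤ 2 + i) (regroup k) (s≤s (s≤s (everyOther-unmarked-pair k i i-unmarked i+1-unmarked)))
  where
  regroup : ∀ k → 2 + (2 * k + 1) ≡ 2 * suc k + 1
  regroup = solve-∀

everyOther-marksNear≤2 : ∀ {n} k i → MarksNear≤ n (everyOther k) i 2
everyOther-marksNear≤2 k i with T? (everyOther k i)
... | yes i-marked = [ i ] , s≤s z≤n , λ where
  _ (inj₁ refl)         _        → hereˡ refl
  _ (inj₂ (inj₁ refl))  j-marked → ⊥-elim (everyOther-apart k i i-marked j-marked)
  _ (inj₂ (inj₂ j+1≡i)) j-marked →
    ⊥-elim (everyOther-apart k _ j-marked (subst (T ∘ everyOther k) (≡-sym j+1≡i) i-marked))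
... | no i-unmarked = i ∸ 1 ∷ suc i ∷ [] , ≤-refl , λ where
  _ (inj₁ refl)         j-marked → ⊥-elim (i-unmarked j-marked)
  _ (inj₂ (inj₁ refl))  _        → thereˡ (hereˡ refl)
  _ (inj₂ (inj₂ j+1≡i)) _        → hereˡ (cong (_∸ 1) j+1≡i)

-- Unmarked positions come in pairs only beyond the last mark 2k, hence not at all when n ≤ 2k + 2.
everyOther-unmarkedNear≤1 : ∀ {n} k i → n ≤ 2 * k + 2 → i < n → T (not (everyOther k i)) →
                            MarksNear≤ n (not ∘ everyOther k) i 1
everyOther-unmarkedNear≤1 {n} k i n≤2k+2 i<n i-unmarked = [ i ] , ≤-refl , listed
  where
  beyond : ∀ {m} → 2 * k + 1 ≤ m → suc m < n → ⊥
  beyond 2k+1≤m m+1<n =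
    <-irrefl refl (≤-trans (s≤s (s≤s 2k+1≤m)) (≤-trans m+1<n (≤-trans n≤2k+2 (≤-reflexive (+-suc (2 * k) 1)))))
  listed : ∀ {j} → j < n → Near i j → T (not (everyOther k j)) → j ∈ˡ [ i ]
  listed _   (inj₁ refl)         _          = hereˡ refl
  listed j<n (inj₂ (inj₁ refl))  j-unmarked =
    ⊥-elim (beyond (everyOther-unmarked-pair k i i-unmarked j-unmarked) j<n)
  listed _   (inj₂ (inj₂ j+1≡i)) j-unmarked = ⊥-elim (beyond
    (everyOther-unmarked-pair k _ j-unmarked (subst (T ∘ not ∘ everyOther k) (≡-sym j+1≡i) i-unmarked))
    (subst (_< n) (≡-sym j+1≡i) i<n))

everyThird : ℕ → ℕ → Bool
everyThird k       zero                = true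
everyThird zero    (suc i)             = false
everyThird (suc k) (suc zero)          = false
everyThird (suc k) (suc (suc zero))    = false
everyThird (suc k) (suc (suc (suc i))) = everyThird k i

∣marks-everyThird∣ : ∀ k n → 3 * k + 1 ≤ n → ∣ marks n (everyThird k) ∣ ≡ k + 1
∣marks-everyThird∣ zero    (suc n) _      = cong suc (∣marks-none∣ n)
∣marks-everyThird∣ (suc k) n       3k+4≤n = shifted n (subst (_≤ n) (regroup k) 3k+4≤n)
  where
  regroup : ∀ k → 3 * suc k + 1 ≡ 3 + (3 * k + 1)
  regroup = solve-∀
  shifted : ∀ n → 3 + (3 * k + 1) ≤ n → ∣ marks n (everyThird (suc k)) ∣ ≡ suc k + 1
  shifted (suc (suc (suc n))) (s≤s (s≤s (s≤s 3k+1≤n))) = cong suc (∣marks-everyThird∣ k n 3k+1≤n)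

everyThird-apart₁ : ∀ k i → T (everyThird k i) → ¬ T (everyThird k (suc i))
everyThird-apart₁ zero    zero                _ ()
everyThird-apart₁ (suc k) zero                _ ()
everyThird-apart₁ (suc k) (suc zero)          ()
everyThird-apart₁ (suc k) (suc (suc zero))    ()
everyThird-apart₁ (suc k) (suc (suc (suc i))) = everyThird-apart₁ k i

everyThird-apart₂ : ∀ k i → T (everyThird k i) → ¬ T (everyThird k (suc (suc i)))
everyThird-apart₂ zero    zero                _ ()
everyThird-apart₂ (suc k) zero                _ ()
everyThird-apart₂ (suc k) (suc zero)          ()
everyThird-apart₂ (suc k) (suc (suc zero))    ()
everyThird-apart₂ (suc k) (suc (suc (suc i))) = everyThird-apart₂ k i

everyThird-unmarked : ∀ k i → suc i ≤ 3 * k + 1 → T (not (everyThird k (suc i))) →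
                      T (everyThird k i) ⊎ T (everyThird k (suc (suc i)))
everyThird-unmarked zero    zero                _ _ = inj₁ _
everyThird-unmarked (suc k) zero                _ _ = inj₁ _
everyThird-unmarked zero    (suc i)             (s≤s ()) _
everyThird-unmarked (suc k) (suc zero)          _ _ = inj₂ _
everyThird-unmarked (suc k) (suc (suc zero))    _ ()
everyThird-unmarked (suc k) (suc (suc (suc i))) i≤3k+4 i-unmarked =
  everyThird-unmarked k i (≤-pred (≤-pred (≤-pred (subst (4 + i ≤_) (regroup k) i≤3k+4)))) i-unmarked
  where
  regroup : ∀ k → 3 * suc k + 1 ≡ 3 + (3 * k + 1)
  regroup = solve-∀

everyThird-marksNear≤1 : ∀ {n} k i → MarksNear≤ n (everyThird k) i 1
everyThird-marksNear≤1 {n} k i with T? (everyThird k i)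
... | yes i-marked = [ i ] , ≤-refl , listed
  where
  listed : ∀ {j} → j < n → Near i j → T (everyThird k j) → j ∈ˡ [ i ]
  listed _ (inj₁ refl)         _        = hereˡ refl
  listed _ (inj₂ (inj₁ refl))  j-marked = ⊥-elim (everyThird-apart₁ k i i-marked j-marked)
  listed _ (inj₂ (inj₂ refl))  j-marked = ⊥-elim (everyThird-apart₁ k _ j-marked i-marked)
everyThird-marksNear≤1 k zero    | no i-unmarked = ⊥-elim (i-unmarked _)
everyThird-marksNear≤1 {n} k (suc i) | no i+1-unmarked with T? (everyThird k i)
... | yes i-marked = [ i ] , ≤-refl , listed
  where
  listed : ∀ {j} → j < n → Near (suc i) j → T (everyThird k j) → j ∈ˡ [ i ]
  listed _ (inj₁ refl)         j-marked = ⊥-elim (i+1-unmarked j-marked)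
  listed _ (inj₂ (inj₁ refl))  j-marked = ⊥-elim (everyThird-apart₂ k i i-marked j-marked)
  listed _ (inj₂ (inj₂ refl))  _        = hereˡ refl
... | no i-unmarked = [ suc (suc i) ] , ≤-refl , listed
  where
  listed : ∀ {j} → j < n → Near (suc i) j → T (everyThird k j) → j ∈ˡ [ suc (suc i) ]
  listed _ (inj₁ refl)         j-marked = ⊥-elim (i+1-unmarked j-marked)
  listed _ (inj₂ (inj₁ refl))  _        = hereˡ refl
  listed _ (inj₂ (inj₂ refl))  j-marked = ⊥-elim (i-unmarked j-marked)

everyThird-unmarkedNear≤2 : ∀ {n} k i → i ≤ 3 * k + 1 → T (not (everyThird k i)) →
                            MarksNear≤ n (not ∘ everyThird k) i 2
everyThird-unmarkedNear≤2 {n} k (suc i) i+1≤3k+1 i+1-unmarked with everyThird-unmarked k i i+1≤3k+1 i+1-unmarked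
... | inj₁ i-marked = suc i ∷ suc (suc i) ∷ [] , ≤-refl , listed
  where
  listed : ∀ {j} → j < n → Near (suc i) j → T (not (everyThird k j)) → j ∈ˡ suc i ∷ suc (suc i) ∷ []
  listed _ (inj₁ refl)         _          = hereˡ refl
  listed _ (inj₂ (inj₁ refl))  _          = thereˡ (hereˡ refl)
  listed _ (inj₂ (inj₂ refl))  j-unmarked = ⊥-elim (T⇒¬T-not i-marked j-unmarked)
... | inj₂ i+2-marked = i ∷ suc i ∷ [] , ≤-refl , listed
  where
  listed : ∀ {j} → j < n → Near (suc i) j → T (not (everyThird k j)) → j ∈ˡ i ∷ suc i ∷ []
  listed _ (inj₁ refl)         _          = thereˡ (hereˡ refl)
  listed _ (inj₂ (inj₁ refl))  j-unmarked = ⊥-elim (T⇒¬T-not i+2-marked j-unmarked)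
  listed _ (inj₂ (inj₂ refl))  _          = hereˡ refl

everyOther-kTRDS : ∀ {n k} → 2 * k + 3 ≤ n → IsKTRDS (Pᶜ n) k (marks n (everyOther (suc k)))
everyOther-kTRDS {n} {k} 2k+3≤n = dominating , restrained
  where
  S = marks n (everyOther (suc k))
  ∣S∣≡k+2 : ∣ S ∣ ≡ k + 2
  ∣S∣≡k+2 = ∣marks-everyOther-suc∣ k 2k+3≤n
  ∁S-bound : ∀ c → k + c + (k + 2) ≤ n → k + c ≤ ∣ ∁ S ∣
  ∁S-bound c le = m+∣p∣≤n⇒m≤∣∁p∣ (k + c) S (subst (λ s → k + c + s ≤ n) (≡-sym ∣S∣≡k+2) le)
  dominating : ∀ x → k ≤ ∣ N (Pᶜ n) x ∩ S ∣
  dominating x = marks-neighbours x (≤-reflexive (≡-sym ∣S∣≡k+2)) (everyOther-marksNear≤2 (suc k) (toℕ x))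
  restrained : ∀ x → x ∉ S → k ≤ ∣ N (Pᶜ n) x ∩ ∁ S ∣
  restrained x x∉S with 2 * k + 5 ≤? n
  ... | yes 2k+5≤n = unmarked-neighbours (everyOther (suc k)) x (∁S-bound 3 (subst (_≤ n) (regroup k) 2k+5≤n))
                     (marksNear≤3 _ (toℕ x))
    where
    regroup : ∀ k → 2 * k + 5 ≡ k + 3 + (k + 2)
    regroup = solve-∀
  ... | no 2k+5≰n = unmarked-neighbours (everyOther (suc k)) x (∁S-bound 1 (subst (_≤ n) (regroup k) 2k+3≤n))
                     (everyOther-unmarkedNear≤1 (suc k) (toℕ x) n≤2k+4 (toℕ<n x)
                       (∉marks⇒T-not (everyOther (suc k)) x∉S))
    where
    regroup : ∀ k → 2 * k + 3 ≡ k + 1 + (k + 2)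
    regroup = solve-∀
    n≤2k+4 : n ≤ 2 * suc k + 2
    n≤2k+4 = ≤-pred (subst (n <_) (regroup′ k) (≰⇒> 2k+5≰n))
      where
      regroup′ : ∀ k → 2 * k + 5 ≡ suc (2 * suc k + 2)
      regroup′ = solve-∀

everyThird-kTRDS : ∀ {n k} → 1 ≤ k → 3 * k + 1 ≤ n → 2 * k + 3 ≤ n → IsKTRDS (Pᶜ n) k (marks n (everyThird k))
everyThird-kTRDS {n} {k} 1≤k 3k+1≤n 2k+3≤n = dominating , restrained
  where
  S = marks n (everyThird k)
  ∣S∣≡k+1 : ∣ S ∣ ≡ k + 1
  ∣S∣≡k+1 = ∣marks-everyThird∣ k n 3k+1≤n
  ∁S-bound : ∀ c → k + c + (k + 1) ≤ n → k + c ≤ ∣ ∁ S ∣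
  ∁S-bound c le = m+∣p∣≤n⇒m≤∣∁p∣ (k + c) S (subst (λ s → k + c + s ≤ n) (≡-sym ∣S∣≡k+1) le)
  dominating : ∀ x → k ≤ ∣ N (Pᶜ n) x ∩ S ∣
  dominating x = marks-neighbours x (≤-reflexive (≡-sym ∣S∣≡k+1)) (everyThird-marksNear≤1 k (toℕ x))
  restrained : ∀ x → x ∉ S → k ≤ ∣ N (Pᶜ n) x ∩ ∁ S ∣
  restrained x x∉S with toℕ x ≤? 3 * k + 1
  ... | yes x≤3k+1 = unmarked-neighbours (everyThird k) x (∁S-bound 2 (subst (_≤ n) (regroup k) 2k+3≤n))
                       (everyThird-unmarkedNear≤2 k (toℕ x) x≤3k+1 (∉marks⇒T-not (everyThird k) x∉S))
    where
    regroup : ∀ k → 2 * k + 3 ≡ k + 2 + (k + 1)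
    regroup = solve-∀
  ... | no x≰3k+1 = unmarked-neighbours (everyThird k) x (∁S-bound 3 (begin
    k + 3 + (k + 1)       ≡⟨ regroup k ⟩
    2 * k + 3 + 1         ≤⟨ +-monoʳ-≤ (2 * k + 3) 1≤k ⟩
    2 * k + 3 + k         ≡⟨ regroup′ k ⟩
    suc (suc (3 * k + 1)) ≤⟨ s≤s (≰⇒> x≰3k+1) ⟩
    suc (toℕ x)           ≤⟨ toℕ<n x ⟩
    n                     ∎)) (marksNear≤3 _ (toℕ x))
    where
    open ≤-Reasoning
    regroup : ∀ k → k + 3 + (k + 1) ≡ 2 * k + 3 + 1
    regroup = solve-∀
    regroup′ : ∀ k → 2 * k + 3 + k ≡ suc (suc (3 * k + 1))
    regroup′ = solve-∀

proposition2p3 : (k n : ℕ) → 1 ≤ k → k + 3 ≤ n →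
    ((n ≡ 4 → GammaKTR≡ (complement (P n)) 1 n) ×
     (5 ≤ n → GammaKTR≡ (complement (P n)) 1 2)) ×
    (2 ≤ k →
      (n ≤ 2 * k + 2 → GammaKTR≡ (complement (P n)) k n) ×
      (2 * k + 3 ≤ n → n ≤ 3 * k → GammaKTR≡ (complement (P n)) k (k + 2)) ×
      (3 * k + 1 ≤ n → GammaKTR≡ (complement (P n)) k (k + 1)))
proposition2p3 k n 1≤k k+3≤n =
    ( (λ n≡4 → (⊤ , ⊤-kTRDS 4≤n , ∣⊤∣≡n n)
               , λ _ → n≤2k+2⇒n≤∣S∣ 4≤n (≤-reflexive n≡4))
    , (λ 5≤n → (marks n (everyThird 1) , everyThird-kTRDS ≤-refl 4≤n 5≤n , ∣marks-everyThird∣ 1 n 4≤n)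
               , λ _ S-kTRDS → kTRDS⇒k+1≤∣S∣ (Pᶜ n) S-kTRDS ≤-refl 0<n))
  , λ 2≤k →
    ( (λ n≤2k+2 → (⊤ , ⊤-kTRDS k+3≤n , ∣⊤∣≡n n)
                  , λ _ → n≤2k+2⇒n≤∣S∣ 4≤n n≤2k+2)
    , (λ 2k+3≤n n≤3k → (marks n (everyOther (suc k)) , everyOther-kTRDS 2k+3≤n , ∣marks-everyOther-suc∣ k 2k+3≤n)
                       , λ _ → n≤3k⇒k+2≤∣S∣ 1≤k 0<n n≤3k)
    , (λ 3k+1≤n → let 2k+3≤n = ≤-trans (2k+3≤3k+1 2≤k) 3k+1≤n in
                  (marks n (everyThird k) , everyThird-kTRDS 1≤k 3k+1≤n 2k+3≤n , ∣marks-everyThird∣ k n 3k+1≤n)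
                  , λ _ S-kTRDS → kTRDS⇒k+1≤∣S∣ (Pᶜ n) S-kTRDS 1≤k 0<n))
  where
  4≤n : 4 ≤ n
  4≤n = ≤-trans (+-monoˡ-≤ 3 1≤k) k+3≤n
  0<n : 0 < n
  0<n = ≤-trans (s≤s z≤n) 4≤n
  2k+3≤3k+1 : 2 ≤ k → 2 * k + 3 ≤ 3 * k + 1
  2k+3≤3k+1 2≤k = begin
    2 * k + 3      ≡⟨ regroup k ⟩
    2 * k + 1 + 2  ≤⟨ +-monoʳ-≤ (2 * k + 1) 2≤k ⟩
    2 * k + 1 + k  ≡⟨ regroup′ k ⟩
    3 * k + 1      ∎
    where
    open ≤-Reasoning
    regroup : ∀ k → 2 * k + 3 ≡ 2 * k + 1 + 2
    regroup = solve-∀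
    regroup′ : ∀ k → 2 * k + 1 + k ≡ 3 * k + 1
    regroup′ = solve-∀
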